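{- Let $N',N''$, $F_{N'},F_{N''}$, $\mathit{EQ}$, $G$, $G^{\mathrm{rlx}}$ be as in the context, and fix a cut of $N',N''$ with subcircuit $M$ below the cut and formula $F_M$. Let $W$ be the set of variables of $F_M$ that are not cut variables. Let $H_{\mathrm{cut}}$ be a formula depending only on the cut variables such that $$\exists W\,[\mathit{EQ}\wedge F_M]\equiv H_{\mathrm{cut}}\wedge \exists W\,[F_M].$$ Then $H_{\mathrm{cut}}$ is a boundary formula for this cut.
   Context: $N'$ (inputs $X'$, internal variables $Y'$, output $z'$) and $N''$ (inputs $X''$, internal variables $Y''$, output $z''$) are single-output combinational Boolean circuits with disjoint variable sets, $|X'|=|X''|$ with a fixed correspondence. $F_{N'}$, $F_{N''}$ are CNF formulas specifying them (satisfying assignments = assignments consistent with all gates). $\mathit{EQ}(X',X'')$ is true iff corresponding inputs are equal. $G=\mathit{EQ}\wedge F_{N'}\wedge F_{N''}$, $G^{\mathrm{rlx}}=F_{N'}\wedge F_{N''}$. A cut is a set of variables of $N'$ and $N''$ (input variables treated as gate outputs) such that every path from an input to an output ($z'$ or $z''$) passes through a cut variable; $M$ is the subcircuit of gates lying below the cut (the gates on paths from the inputs to the cut variables, including the gates producing cut variables), $F_M$ is the subformula of $F_{N'}\wedge F_{N''}$ specifying the gates of $M$, and the remaining gates form the part above the cut. A formula $H_{\mathrm{cut}}$ over cut variables only is a boundary formula for the cut if (a) $G\rightarrow H_{\mathrm{cut}}$, and (b) for every assignment $\vec q$ to the cut variables that can be extended to an assignment satisfying $G^{\mathrm{rlx}}$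 but cannot be extended to one satisfying $G$, $H_{\mathrm{cut}}(\vec q)=0$. $\exists W[\cdot]$ is existential quantification over $W$ and $\equiv$ logical equivalence. -}

module Defs where

open import Data.Nat using (ℕ; _<_)
open import Data.Fin using (Fin; toℕ)
open import Data.Bool using (Bool; true; false)
open import Data.List using (List; map)
open import Data.List.Membership.Propositional using (_∈_)
open import Data.Sum using (_⊎_; inj₁; inj₂)
open import Data.Product using (Σ; ∃; _×_)
open import Relation.Binary.PropositionalEquality using (_≡_)
open import Relation.Nullary using (¬_)
open import Function.Bundles using (_⇔_)

Node : (n m : ℕ) → Set
Node n m = Fin n ⊎ Fin m

record Circuit (n : ℕ) : Set where
  field
    m       : ℕ
    fanin   : Fin m → List (Node n m)
    op      : Fin m → List Bool → Bool
    acyclic : ∀ g h → inj₂ h ∈ fanin g → toℕ h < toℕ g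
    out     : Node n m
open Circuit public

module _ {n : ℕ} (N₁ N₂ : Circuit n) where

  -- variables of N' (left) and N'' (right): disjoint by construction;
  -- input i of N' corresponds to input i of N''.
  Var : Set
  Var = Node n (m N₁) ⊎ Node n (m N₂)

  Assignment : Set
  Assignment = Var → Bool

  Gate : Set
  Gate = Fin (m N₁) ⊎ Fin (m N₂)

  gateOut : Gate → Var
  gateOut (inj₁ g) = inj₁ (inj₂ g)
  gateOut (inj₂ g) = inj₂ (inj₂ g)

  gateIns : Gate → List Var
  gateIns (inj₁ g) = map inj₁ (fanin N₁ g)
  gateIns (inj₂ g) = map inj₂ (fanin N₂ g)

  gateOp : Gate → List Bool → Bool
  gateOp (inj₁ g) = op N₁ g
  gateOp (inj₂ g) = op N₂ g

  GateOK : Assignment → Gate → Set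
  GateOK a γ = a (gateOut γ) ≡ gateOp γ (map a (gateIns γ))

  F₁ : Assignment → Set
  F₁ a = ∀ g → GateOK a (inj₁ g)

  F₂ : Assignment → Set
  F₂ a = ∀ g → GateOK a (inj₂ g)

  EQ : Assignment → Set
  EQ a = ∀ (i : Fin n) → a (inj₁ (inj₁ i)) ≡ a (inj₂ (inj₁ i))

  G : Assignment → Set
  G a = EQ a × F₁ a × F₂ a

  Grlx : Assignment → Set
  Grlx a = F₁ a × F₂ a

  IsInput : Var → Set
  IsInput v = Σ (Fin n) λ i → (v ≡ inj₁ (inj₁ i)) ⊎ (v ≡ inj₂ (inj₁ i))

  IsOutput : Var → Set
  IsOutput v = (v ≡ inj₁ (out N₁)) ⊎ (v ≡ inj₂ (out N₂))

  Edge : Var → Var → Set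
  Edge u v = Σ Gate λ γ → (gateOut γ ≡ v) × (u ∈ gateIns γ)

  data Path : Var → Var → Set where
    stop : ∀ v → Path v v
    step : ∀ {u w v} → Edge u w → Path w v → Path u v

  OnPath : ∀ {u v} → Var → Path u v → Set
  OnPath x (stop v)           = x ≡ v
  OnPath {u} x (step _ p)     = (x ≡ u) ⊎ OnPath x p

  InCut : (Var → Bool) → Var → Set
  InCut cut v = cut v ≡ true

  IsCut : (Var → Bool) → Set
  IsCut cut = ∀ s z → IsInput s → IsOutput z → (p : Path s z) →
              Σ Var λ x → OnPath x p × InCut cut x

  InM : (Var → Bool) → Gate → Set
  InM cut γ = Σ Var λ c → InCut cut c × Path (gateOut γ) c

  FM : (Var → Bool) → Assignment → Set
  FM cut a = ∀ γ → InM cut γ → GateOK a γ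

  VarFM : (Var → Bool) → Var → Set
  VarFM cut v = Σ Gate λ γ → InM cut γ × ((v ≡ gateOut γ) ⊎ (v ∈ gateIns γ))

  InW : (Var → Bool) → Var → Set
  InW cut v = VarFM cut v × ¬ InCut cut v

  ExistsW : (Var → Bool) → (Assignment → Set) → Assignment → Set
  ExistsW cut φ a = Σ Assignment λ b → (∀ v → ¬ InW cut v → b v ≡ a v) × φ b

  DependsOnlyOnCut : (Var → Bool) → (Assignment → Bool) → Set
  DependsOnlyOnCut cut H = ∀ a b → (∀ v → InCut cut v → a v ≡ b v) → H a ≡ H b

  -- the cut assignment (encoded by any full assignment q, only cut values matter)
  -- extends to an assignment satisfying φ
  Extendable : (Var → Bool) → (Assignment → Set) → Assignment → Set
  Extendable cut φ q = Σ Assignment λ a → (∀ v → InCut cut v → a v ≡ q v) × φ a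

  IsBoundary : (Var → Bool) → (Assignment → Bool) → Set
  IsBoundary cut H =
      (∀ a → G a → H a ≡ true)
    × (∀ q → Extendable cut Grlx q → ¬ Extendable cut G q → H q ≡ false)

-- Part (a) is the forward implication of the hypothesis applied to a
-- itself.  For part (b), if H q holds and q extends to a model of G^rlx
-- via a, the backward implication at a gives an assignment b satisfying
-- EQ and F_M that agrees with q on the cut.  Evaluating both circuits on
-- the inputs of b yields a model of G, and it agrees with b on the cut
-- because every cut variable is computed by gates of M, whose constraints
-- b satisfies.
module Submission where

open import Defs
open import Data.Nat using (ℕ; zero; suc; _<_; s≤s)
open import Data.Nat.Properties using (<-≤-trans; n<1+n)
open import Data.Fin using (Fin; toℕ)
open import Data.Bool using (Bool; true; false)
open import Data.Bool.Properties using (¬-not)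
open import Data.List using (map)
open import Data.List.Membership.Propositional using (_∈_)
open import Data.List.Membership.Propositional.Properties using (∈-map⁺)
open import Data.List.Properties using (map-∘; map-cong-local)
open import Data.List.Relation.Unary.All using (tabulate)
open import Data.Sum using (inj₁; inj₂)
open import Data.Product using (_×_; _,_; proj₁; proj₂)
open import Function using (_∘_)
open import Relation.Binary.PropositionalEquality using (_≡_; refl; sym; trans; cong)
open import Relation.Nullary using (¬_)
open import Function.Bundles using (_⇔_; mk⇔; Equivalence)

FaninClosed : ∀ {n} (C : Circuit n) → (Fin (m C) → Set) → Set
FaninClosed C P = ∀ g h → P g → inj₂ h ∈ fanin C g → P h

module Evaluation {n : ℕ} (C : Circuit n) (ι : Fin n → Bool) where

  -- Evaluation with fuel k; it is correct on gates g with toℕ g < k.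
  mutual
    nodeWithin : ℕ → Node n (m C) → Bool
    nodeWithin k (inj₁ i) = ι i
    nodeWithin k (inj₂ g) = gateWithin k g

    gateWithin : ℕ → Fin (m C) → Bool
    gateWithin zero    g = false
    gateWithin (suc k) g = op C g (map (nodeWithin k) (fanin C g))

  gateWithin-stable : ∀ k k' g → toℕ g < k → toℕ g < k' →
                      gateWithin k g ≡ gateWithin k' g
  gateWithin-stable (suc k) (suc k') g (s≤s g<k) (s≤s g<k') =
    cong (op C g) (map-cong-local (tabulate λ
      { {inj₁ i} _   → refl
      ; {inj₂ h} h∈ → gateWithin-stable k k' h
                        (<-≤-trans (acyclic C g h h∈) g<k)
                        (<-≤-trans (acyclic C g h h∈) g<k') }))

  value : Node n (m C) → Bool
  value (inj₁ i) = ι i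
  value (inj₂ g) = gateWithin (suc (toℕ g)) g

  value-gate : ∀ g → value (inj₂ g) ≡ op C g (map value (fanin C g))
  value-gate g = cong (op C g) (map-cong-local (tabulate λ
    { {inj₁ i} _   → refl
    ; {inj₂ h} h∈ → gateWithin-stable (toℕ g) (suc (toℕ h)) h
                      (acyclic C g h h∈) (n<1+n (toℕ h)) }))

  value-unique : ∀ {P : Fin (m C) → Set} (ν : Node n (m C) → Bool) →
                 FaninClosed C P →
                 (∀ i → ν (inj₁ i) ≡ ι i) →
                 (∀ g → P g → ν (inj₂ g) ≡ op C g (map ν (fanin C g))) →
                 ∀ g → P g → value (inj₂ g) ≡ ν (inj₂ g)
  value-unique {P} ν closed inputs gates g Pg = within (suc (toℕ g)) g (n<1+n (toℕ g)) Pg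
    where
    within : ∀ k g → toℕ g < k → P g → gateWithin k g ≡ ν (inj₂ g)
    within (suc k) g (s≤s g<k) Pg = trans
      (cong (op C g) (map-cong-local (tabulate λ
        { {inj₁ i} _   → sym (inputs i)
        ; {inj₂ h} h∈ → within k h (<-≤-trans (acyclic C g h h∈) g<k)
                                    (closed g h Pg h∈) })))
      (sym (gates g Pg))

module _ {n : ℕ} (N₁ N₂ : Circuit n) where

  gateOK-left : ∀ a g → GateOK N₁ N₂ a (inj₁ g) ⇔
                (a (inj₁ (inj₂ g)) ≡ op N₁ g (map (a ∘ inj₁) (fanin N₁ g)))
  gateOK-left a g = mk⇔ (λ ok → trans ok (cong (op N₁ g) (sym (map-∘ (fanin N₁ g)))))
                        (λ ok → trans ok (cong (op N₁ g) (map-∘ (fanin N₁ g))))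

  gateOK-right : ∀ a g → GateOK N₁ N₂ a (inj₂ g) ⇔
                 (a (inj₂ (inj₂ g)) ≡ op N₂ g (map (a ∘ inj₂) (fanin N₂ g)))
  gateOK-right a g = mk⇔ (λ ok → trans ok (cong (op N₂ g) (sym (map-∘ (fanin N₂ g)))))
                         (λ ok → trans ok (cong (op N₂ g) (map-∘ (fanin N₂ g))))

  evaluate : Assignment N₁ N₂ → Assignment N₁ N₂
  evaluate a (inj₁ x) = Evaluation.value N₁ (λ i → a (inj₁ (inj₁ i))) x
  evaluate a (inj₂ x) = Evaluation.value N₂ (λ i → a (inj₂ (inj₁ i))) x

  evaluate-F₁ : ∀ a → F₁ N₁ N₂ (evaluate a)
  evaluate-F₁ a g = Equivalence.from (gateOK-left (evaluate a) g)
                      (Evaluation.value-gate N₁ (λ i → a (inj₁ (inj₁ i))) g)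

  evaluate-F₂ : ∀ a → F₂ N₁ N₂ (evaluate a)
  evaluate-F₂ a g = Equivalence.from (gateOK-right (evaluate a) g)
                      (Evaluation.value-gate N₂ (λ i → a (inj₂ (inj₁ i))) g)

  F₁×F₂⇒FM : ∀ cut a → F₁ N₁ N₂ a → F₂ N₁ N₂ a → FM N₁ N₂ cut a
  F₁×F₂⇒FM cut a f₁ f₂ (inj₁ g) _ = f₁ g
  F₁×F₂⇒FM cut a f₁ f₂ (inj₂ g) _ = f₂ g

  module _ (cut : Var N₁ N₂ → Bool) where

    InM-faninClosed-left : FaninClosed N₁ (λ g → InM N₁ N₂ cut (inj₁ g))
    InM-faninClosed-left g h (c , c∈cut , g⇝c) h∈ =
      c , c∈cut , step (inj₁ g , refl , ∈-map⁺ inj₁ h∈) g⇝c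

    InM-faninClosed-right : FaninClosed N₂ (λ g → InM N₁ N₂ cut (inj₂ g))
    InM-faninClosed-right g h (c , c∈cut , g⇝c) h∈ =
      c , c∈cut , step (inj₂ g , refl , ∈-map⁺ inj₂ h∈) g⇝c

    evaluate-onCut : ∀ a → FM N₁ N₂ cut a → ∀ v → InCut N₁ N₂ cut v → evaluate a v ≡ a v
    evaluate-onCut a fm (inj₁ (inj₁ i)) _ = refl
    evaluate-onCut a fm (inj₂ (inj₁ i)) _ = refl
    evaluate-onCut a fm (inj₁ (inj₂ g)) g∈cut =
      Evaluation.value-unique N₁ _ (a ∘ inj₁) InM-faninClosed-left (λ _ → refl)
        (λ h h∈M → Equivalence.to (gateOK-left a h) (fm (inj₁ h) h∈M))
        g (_ , g∈cut , stop _)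
    evaluate-onCut a fm (inj₂ (inj₂ g)) g∈cut =
      Evaluation.value-unique N₂ _ (a ∘ inj₂) InM-faninClosed-right (λ _ → refl)
        (λ h h∈M → Equivalence.to (gateOK-right a h) (fm (inj₂ h) h∈M))
        g (_ , g∈cut , stop _)

    ExistsW-self : ∀ {φ : Assignment N₁ N₂ → Set} a → φ a → ExistsW N₁ N₂ cut φ a
    ExistsW-self a φa = a , (λ _ _ → refl) , φa

    Extendable-onCut : ∀ {φ : Assignment N₁ N₂ → Set} a q →
                       (∀ v → InCut N₁ N₂ cut v → a v ≡ q v) →
                       Extendable N₁ N₂ cut φ a → Extendable N₁ N₂ cut φ q
    Extendable-onCut a q a≈q (b , b≈a , φb) =
      b , (λ v v∈cut → trans (b≈a v v∈cut) (a≈q v v∈cut)) , φb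

    ExistsW-EQ×FM⇒Extendable-G : ∀ a →
      ExistsW N₁ N₂ cut (λ b → EQ N₁ N₂ b × FM N₁ N₂ cut b) a →
      Extendable N₁ N₂ cut (G N₁ N₂) a
    ExistsW-EQ×FM⇒Extendable-G a (b , b≈a , eq , fm) =
      evaluate b ,
      (λ v v∈cut → trans (evaluate-onCut b fm v v∈cut) (b≈a v (λ v∈W → proj₂ v∈W v∈cut))) ,
      eq , evaluate-F₁ b , evaluate-F₂ b

proposition2 : ∀ {n} (N₁ N₂ : Circuit n) (cut : Var N₁ N₂ → Bool)
    (H : Assignment N₁ N₂ → Bool) →
    IsCut N₁ N₂ cut →
    DependsOnlyOnCut N₁ N₂ cut H →
    (∀ a → ExistsW N₁ N₂ cut (λ b → EQ N₁ N₂ b × FM N₁ N₂ cut b) a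
    ⇔ (H a ≡ true × ExistsW N₁ N₂ cut (FM N₁ N₂ cut) a)) →
    IsBoundary N₁ N₂ cut H
proposition2 N₁ N₂ cut H _ H-onCut H-spec = G⇒H , unrealisable⇒¬H
  where
  G⇒H : ∀ a → G N₁ N₂ a → H a ≡ true
  G⇒H a (eq , f₁ , f₂) =
    proj₁ (Equivalence.to (H-spec a)
      (ExistsW-self N₁ N₂ cut a (eq , F₁×F₂⇒FM N₁ N₂ cut a f₁ f₂)))

  unrealisable⇒¬H : ∀ q → Extendable N₁ N₂ cut (Grlx N₁ N₂) q →
                    ¬ Extendable N₁ N₂ cut (G N₁ N₂) q → H q ≡ false
  unrealisable⇒¬H q (a , a≈q , f₁ , f₂) ¬G-q = ¬-not λ Hq → ¬G-q
    (Extendable-onCut N₁ N₂ cut a q a≈q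
      (ExistsW-EQ×FM⇒Extendable-G N₁ N₂ cut a
        (Equivalence.from (H-spec a)
          (trans (H-onCut a q a≈q) Hq ,
           ExistsW-self N₁ N₂ cut a (F₁×F₂⇒FM N₁ N₂ cut a f₁ f₂)))))
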